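{- Let $G$ be a graph with girth $g$, and let $k$ be an integer with $k<\lfloor g/2\rfloor$. If $S$ is a $k$-distance mutual-visibility set of $G$ with $|S|\ge 3$, then $S$ is an independent set of $G$.
   Context: All graphs are finite, simple, undirected and connected. The girth is the length of a shortest cycle. For a graph $G$, a set $S\subseteq V(G)$ and an integer $k\ge 1$, two vertices $x,y$ are $S_k$-visible if there is a shortest $x,y$-path of length at most $k$ none of whose internal vertices lies in $S$. $S$ is a $k$-distance mutual-visibility set if every two vertices of $S$ are $S_k$-visible. -}

module Defs where

open import Data.Nat using (ℕ; zero; suc; _≤_; _<_; _/_)
open import Data.Fin using (Fin; zero; suc; toℕ; inject₁; fromℕ)
open import Data.Fin.Subset using (Subset; _∈_; _∉_; ∣_∣)
open import Data.Product using (Σ; ∃; ∃-syntax; _×_)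
open import Relation.Nullary using (¬_)
open import Relation.Binary.PropositionalEquality using (_≡_)

record Graph : Set₁ where
  field
    n      : ℕ
    Adj    : Fin n → Fin n → Set
    sym    : ∀ {x y} → Adj x y → Adj y x
    irrefl : ∀ {x} → ¬ Adj x x

  V : Set
  V = Fin n

  record Walk (x y : V) (ℓ : ℕ) : Set where
    field
      vert  : Fin (suc ℓ) → V
      start : vert zero ≡ x
      end   : vert (fromℕ ℓ) ≡ y
      step  : ∀ (i : Fin ℓ) → Adj (vert (inject₁ i)) (vert (suc i))

  InternallyAvoids : ∀ {x y ℓ} → Walk x y ℓ → Subset n → Set
  InternallyAvoids {ℓ = ℓ} p S =
    ∀ (i : Fin (suc ℓ)) → 0 < toℕ i → toℕ i < ℓ → Walk.vert p i ∉ S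

  -- A walk of length ℓ is a shortest x,y-path if no x,y-walk is shorter
  -- (a shortest walk is automatically a path).
  IsShortest : ∀ {x y ℓ} → Walk x y ℓ → Set
  IsShortest {x} {y} {ℓ} _ = ∀ m → m < ℓ → ¬ Walk x y m

  HasCycleOfLength : ℕ → Set
  HasCycleOfLength ℓ =
    3 ≤ ℓ × ∃[ x ] Σ (Walk x x ℓ) λ p →
      ∀ (i j : Fin ℓ) → Walk.vert p (inject₁ i) ≡ Walk.vert p (inject₁ j) → i ≡ j

  Girth : ℕ → Set
  Girth g = HasCycleOfLength g × (∀ ℓ → HasCycleOfLength ℓ → g ≤ ℓ)

  Visible : Subset n → ℕ → V → V → Set
  Visible S k x y =
    ∃[ ℓ ] ℓ ≤ k × Σ (Walk x y ℓ) λ p → IsShortest p × InternallyAvoids p S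

  IsKDistMV : ℕ → Subset n → Set
  IsKDistMV k S = ∀ x y → x ∈ S → y ∈ S → Visible S k x y

  Independent : Subset n → Set
  Independent S = ∀ x y → x ∈ S → y ∈ S → ¬ Adj x y

  Connected : Set
  Connected = ∀ x y → ∃[ ℓ ] Walk x y ℓ

{-# OPTIONS --safe #-}
-- Suppose two members x, y of S were adjacent and pick a third member z. The
-- shortest x,z- and y,z-paths granted by visibility have length at most k and
-- avoid S internally, so the second vertex of neither is the other one of x, y.
-- Cut off the final segment the two paths share; what is left, closed up by the
-- edge yx, is a closed walk of length at most 2k + 1 < g that never immediately
-- backtracks. Such a walk contains a cycle no longer than itself, because a
-- shortest closed subwalk is a cycle: it cannot have length 1 (no loops) or
-- 2 (no backtracking).
module Submission where

open import Defs
open import Data.Nat using (ℕ; _≤_; _<_; _/_)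
open import Data.Fin.Subset using (Subset; ∣_∣)

open import Data.Nat using (zero; suc; _+_; _∸_; _*_; z≤n; s≤s; _<?_)
open import Data.Nat.Properties
open import Data.Nat.DivMod using (m/n*n≤m)
open import Data.Nat.Induction using (<-rec)
open import Data.Fin as Fin using (Fin; toℕ; inject₁; fromℕ; fromℕ<)
open import Data.Fin.Properties
  using (any?; toℕ<n; toℕ-fromℕ; toℕ-fromℕ<; fromℕ<-toℕ; toℕ-inject₁)
  renaming (_≟_ to _≟ᶠ_; _<?_ to _<ᶠ?_; <-cmp to <ᶠ-cmp)
open import Data.Fin.Subset using (_∈_; _∪_; ⁅_⁆; _⊆_; inside; outside)
open import Data.Fin.Subset.Properties
  using (_∈?_; p⊆q⇒∣p∣≤∣q∣; x∈⁅x⁆; p⊆p∪q; q⊆p∪q; ∣⁅x⁆∣≡1)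
open import Data.Vec using (_∷_; [])
open import Data.Product using (∃-syntax; ∃₂; _×_; _,_)
open import Data.Empty using (⊥-elim)
open import Function using (_∘_)
open import Function.Definitions using (Injective)
open import Relation.Nullary using (¬_; Dec; yes; no)
open import Relation.Nullary.Decidable using (_×-dec_; ¬?)
open import Relation.Binary.Definitions using (DecidableEquality; tri<; tri≈; tri>)
open import Relation.Binary.PropositionalEquality

∣p∪q∣≤∣p∣+∣q∣ : ∀ {n} (p q : Subset n) → ∣ p ∪ q ∣ ≤ ∣ p ∣ + ∣ q ∣
∣p∪q∣≤∣p∣+∣q∣ []            []            = z≤n
∣p∪q∣≤∣p∣+∣q∣ (inside  ∷ p) (inside  ∷ q) =
  s≤s (≤-trans (∣p∪q∣≤∣p∣+∣q∣ p q) (+-monoʳ-≤ ∣ p ∣ (n≤1+n ∣ q ∣)))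
∣p∪q∣≤∣p∣+∣q∣ (inside  ∷ p) (outside ∷ q) = s≤s (∣p∪q∣≤∣p∣+∣q∣ p q)
∣p∪q∣≤∣p∣+∣q∣ (outside ∷ p) (inside  ∷ q) =
  subst (suc ∣ p ∪ q ∣ ≤_) (sym (+-suc ∣ p ∣ ∣ q ∣)) (s≤s (∣p∪q∣≤∣p∣+∣q∣ p q))
∣p∪q∣≤∣p∣+∣q∣ (outside ∷ p) (outside ∷ q) = ∣p∪q∣≤∣p∣+∣q∣ p q

third-element : ∀ {n} (p : Subset n) (x y : Fin n) → 3 ≤ ∣ p ∣ →
                ∃[ z ] z ∈ p × z ≢ x × z ≢ y
third-element p x y 3≤∣p∣ with any? (λ z → z ∈? p ×-dec ¬? (z ≟ᶠ x) ×-dec ¬? (z ≟ᶠ y))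
... | yes found = found
... | no none   = ⊥-elim (<⇒≱ 3≤∣p∣ ∣p∣≤2)
  where
  p⊆⁅x⁆∪⁅y⁆ : p ⊆ ⁅ x ⁆ ∪ ⁅ y ⁆
  p⊆⁅x⁆∪⁅y⁆ {z} z∈p with z ≟ᶠ x | z ≟ᶠ y
  ... | yes refl | _        = p⊆p∪q ⁅ y ⁆ (x∈⁅x⁆ x)
  ... | no _     | yes refl = q⊆p∪q ⁅ x ⁆ ⁅ y ⁆ (x∈⁅x⁆ y)
  ... | no z≢x   | no z≢y   = ⊥-elim (none (z , z∈p , z≢x , z≢y))

  open ≤-Reasoning
  ∣p∣≤2 : ∣ p ∣ ≤ 2
  ∣p∣≤2 = begin
    ∣ p ∣                   ≤⟨ p⊆q⇒∣p∣≤∣q∣ p⊆⁅x⁆∪⁅y⁆ ⟩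
    ∣ ⁅ x ⁆ ∪ ⁅ y ⁆ ∣       ≤⟨ ∣p∪q∣≤∣p∣+∣q∣ ⁅ x ⁆ ⁅ y ⁆ ⟩
    ∣ ⁅ x ⁆ ∣ + ∣ ⁅ y ⁆ ∣   ≡⟨ cong₂ _+_ (∣⁅x⁆∣≡1 x) (∣⁅x⁆∣≡1 y) ⟩
    2                       ∎

m<n/2⇒1+2m<n : ∀ {m n} → m < n / 2 → suc (m + m) < n
m<n/2⇒1+2m<n {m} {n} m<n/2 = begin
  2 + (m + m)           ≡⟨ cong suc (sym (+-suc m m)) ⟩
  suc m + suc m         ≡⟨ cong (suc m +_) (sym (+-identityʳ (suc m))) ⟩
  2 * suc m             ≤⟨ *-monoʳ-≤ 2 m<n/2 ⟩
  2 * (n / 2)           ≡⟨ *-comm 2 (n / 2) ⟩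
  n / 2 * 2             ≤⟨ m/n*n≤m n 2 ⟩
  n                     ∎
  where open ≤-Reasoning

Collides : ∀ {d} {A : Set} → (Fin d → A) → Set
Collides f = ∃₂ λ r r' → r Fin.< r' × f r ≡ f r'

collides? : ∀ {d} {A : Set} → DecidableEquality A → (f : Fin d → A) → Dec (Collides f)
collides? _≟_ f = any? λ r → any? λ r' → (r <ᶠ? r') ×-dec (f r ≟ f r')

¬collides⇒injective : ∀ {d} {A : Set} {f : Fin d → A} → ¬ Collides f → Injective _≡_ _≡_ f
¬collides⇒injective none {r} {r'} same with <ᶠ-cmp r r'
... | tri< r<r' _ _ = ⊥-elim (none (r , r' , r<r' , same))
... | tri≈ _ r≡r' _ = r≡r'
... | tri> _ _ r'<r = ⊥-elim (none (r' , r , r'<r , sym same))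

splice : ∀ {A : Set} → ℕ → (ℕ → A) → (ℕ → A) → ℕ → A
splice zero    f g i       = g i
splice (suc a) f g zero    = f zero
splice (suc a) f g (suc i) = splice a (f ∘ suc) g i

splice-≤ : ∀ {A : Set} a (f g : ℕ → A) {i} → f a ≡ g 0 → i ≤ a → splice a f g i ≡ f i
splice-≤ zero    f g         f₀≡g₀ z≤n       = sym f₀≡g₀
splice-≤ (suc a) f g {zero}  _     _         = refl
splice-≤ (suc a) f g {suc i} fₐ≡g₀ (s≤s i≤a) = splice-≤ a (f ∘ suc) g fₐ≡g₀ i≤a

splice-+ : ∀ {A : Set} a (f g : ℕ → A) j → splice a f g (a + j) ≡ g j
splice-+ zero    f g j = refl
splice-+ (suc a) f g j = splice-+ a (f ∘ suc) g j

splice-step : ∀ {A : Set} {R : A → A → Set} a {b} (f g : ℕ → A) →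
              (∀ i → i < a → R (f i) (f (suc i))) → (∀ j → j < b → R (g j) (g (suc j))) →
              f a ≡ g 0 → ∀ i → i < a + b → R (splice a f g i) (splice a f g (suc i))
splice-step zero    f g _      g-steps _     i       i<b     = g-steps i i<b
splice-step {R = R} (suc a) f g f-steps _ fₐ≡g₀ zero _ =
  subst (R (f 0)) (sym (splice-≤ a (f ∘ suc) g fₐ≡g₀ z≤n)) (f-steps 0 (s≤s z≤n))
splice-step {R = R} (suc a) f g f-steps g-steps fₐ≡g₀ (suc i) (s≤s i<a+b) =
  splice-step {R = R} a (f ∘ suc) g (λ i → f-steps (suc i) ∘ s≤s) g-steps fₐ≡g₀ i i<a+b

NonBacktracking : ∀ {A : Set} → (ℕ → A) → ℕ → Set
NonBacktracking f ℓ = ∀ t → 2 + t ≤ ℓ → f t ≢ f (2 + t)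

nonBacktracking-shift : ∀ {A : Set} {f : ℕ → A} {ℓ j} → j ≤ ℓ →
                        NonBacktracking f ℓ → NonBacktracking (λ i → f (i + j)) (ℓ ∸ j)
nonBacktracking-shift {j = j} j≤ℓ nb t le = nb (t + j) (m≤o∸n⇒m+n≤o (2 + t) j≤ℓ le)

splice-nonBacktracking : ∀ {A : Set} a {b} (f g : ℕ → A) →
  NonBacktracking f (suc a) → NonBacktracking g b → f (suc a) ≡ g 0 → f a ≢ g 1 →
  NonBacktracking (splice (suc a) f g) (suc a + b)
splice-nonBacktracking zero    f g _    _    _     f₀≢g₁ zero    _          = f₀≢g₁
splice-nonBacktracking zero    f g _    g-nb _     _     (suc t) (s≤s le)   = g-nb t le
splice-nonBacktracking (suc a) f g f-nb _    fₐ≡g₀ _     zero    _          =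
  subst (f 0 ≢_) (sym (splice-≤ (suc a) (f ∘ suc) g fₐ≡g₀ (s≤s z≤n))) (f-nb 0 (s≤s (s≤s z≤n)))
splice-nonBacktracking (suc a) f g f-nb g-nb fₐ≡g₀ sep   (suc t) (s≤s le) =
  splice-nonBacktracking a (f ∘ suc) g (λ t → f-nb (suc t) ∘ s≤s) g-nb fₐ≡g₀ sep t le

module _ (G : Graph) where
  open Graph G renaming (sym to Adj-sym)

  -- Walks with ℕ-indexed vertices; indices beyond the length carry junk.
  -- Cutting and joining walks then becomes index arithmetic on ℕ.
  record Walkℕ (x y : V) (ℓ : ℕ) : Set where
    field
      vert  : ℕ → V
      start : vert 0 ≡ x
      end   : vert ℓ ≡ y
      step  : ∀ i → i < ℓ → Adj (vert i) (vert (suc i))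
  open Walkℕ

  walkVert : ∀ {x y ℓ} → Walk x y ℓ → ℕ → V
  walkVert {y = y} {ℓ} p i with i <? suc ℓ
  ... | yes i≤ℓ = Walk.vert p (fromℕ< i≤ℓ)
  ... | no _    = y

  walkVert-toℕ : ∀ {x y ℓ} (p : Walk x y ℓ) (r : Fin (suc ℓ)) {i} → toℕ r ≡ i →
                 walkVert p i ≡ Walk.vert p r
  walkVert-toℕ {ℓ = ℓ} p r refl with toℕ r <? suc ℓ
  ... | yes r≤ℓ = cong (Walk.vert p) (fromℕ<-toℕ r r≤ℓ)
  ... | no r≰ℓ  = ⊥-elim (r≰ℓ (toℕ<n r))

  fromWalk : ∀ {x y ℓ} → Walk x y ℓ → Walkℕ x y ℓ
  fromWalk {ℓ = ℓ} p = record
    { vert  = walkVert p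
    ; start = trans (walkVert-toℕ p Fin.zero refl) (Walk.start p)
    ; end   = trans (walkVert-toℕ p (fromℕ ℓ) (toℕ-fromℕ ℓ)) (Walk.end p)
    ; step  = λ i i<ℓ → let r = fromℕ< i<ℓ in
        subst₂ Adj (sym (walkVert-toℕ p (inject₁ r) (trans (toℕ-inject₁ r) (toℕ-fromℕ< i<ℓ))))
                   (sym (walkVert-toℕ p (Fin.suc r) (cong suc (toℕ-fromℕ< i<ℓ))))
                   (Walk.step p r)
    }

  toWalk : ∀ {x y ℓ} → Walkℕ x y ℓ → Walk x y ℓ
  toWalk {ℓ = ℓ} P = record
    { vert  = vert P ∘ toℕ
    ; start = start P
    ; end   = trans (cong (vert P) (toℕ-fromℕ ℓ)) (end P)
    ; step  = λ r → subst (λ i → Adj (vert P i) (vert P (suc (toℕ r)))) (sym (toℕ-inject₁ r))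
                          (step P (toℕ r) (toℕ<n r))
    }

  empty-walk-endpoints : ∀ {x y} → Walkℕ x y 0 → x ≡ y
  empty-walk-endpoints P = trans (sym (start P)) (end P)

  edge : ∀ {x y} → Adj x y → Walkℕ x y 1
  edge {x} {y} xy = record
    { vert  = λ { zero → x ; (suc _) → y }
    ; start = refl
    ; end   = refl
    ; step  = λ { zero _ → xy ; (suc _) (s≤s ()) }
    }

  retarget : ∀ {x y y' ℓ} → Walkℕ x y ℓ → y ≡ y' → Walkℕ x y' ℓ
  retarget P y≡y' = record
    { vert  = vert P
    ; start = start P
    ; end   = trans (end P) y≡y'
    ; step  = step P
    }

  take : ∀ {x y ℓ} (P : Walkℕ x y ℓ) j → j ≤ ℓ → Walkℕ x (vert P j) j
  take P j j≤ℓ = record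
    { vert  = vert P
    ; start = start P
    ; end   = refl
    ; step  = λ i i<j → step P i (<-≤-trans i<j j≤ℓ)
    }

  drop : ∀ {x y ℓ} (P : Walkℕ x y ℓ) j → j ≤ ℓ → Walkℕ (vert P j) y (ℓ ∸ j)
  drop P j j≤ℓ = record
    { vert  = λ i → vert P (i + j)
    ; start = refl
    ; end   = trans (cong (vert P) (m∸n+n≡m j≤ℓ)) (end P)
    ; step  = λ i i<ℓ∸j → step P (i + j) (m≤o∸n⇒m+n≤o (suc i) j≤ℓ i<ℓ∸j)
    }

  _++_ : ∀ {x y z a b} → Walkℕ x y a → Walkℕ y z b → Walkℕ x z (a + b)
  _++_ {a = a} {b} P Q = record
    { vert  = splice a (vert P) (vert Q)
    ; start = trans (splice-≤ a (vert P) (vert Q) junction z≤n) (start P)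
    ; end   = trans (splice-+ a (vert P) (vert Q) b) (end Q)
    ; step  = splice-step {R = Adj} a (vert P) (vert Q) (step P) (step Q) junction
    }
    where
    junction : vert P a ≡ vert Q 0
    junction = trans (end P) (sym (start Q))

  reverse : ∀ {x y ℓ} → Walkℕ x y ℓ → Walkℕ y x ℓ
  reverse {ℓ = ℓ} P = record
    { vert  = λ i → vert P (ℓ ∸ i)
    ; start = end P
    ; end   = trans (cong (vert P) (n∸n≡0 ℓ)) (start P)
    ; step  = λ i i<ℓ → Adj-sym (subst (λ j → Adj (vert P (ℓ ∸ suc i)) (vert P j))
                                       (sym (+-∸-assoc 1 i<ℓ))
                                       (step P (ℓ ∸ suc i) (∸-monoʳ-< (s≤s z≤n) i<ℓ)))
    }

  Shortest : ∀ {x y ℓ} → Walkℕ x y ℓ → Set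
  Shortest {x} {y} {ℓ} _ = ∀ {m} → Walkℕ x y m → ℓ ≤ m

  shortest-fromWalk : ∀ {x y ℓ} (p : Walk x y ℓ) → IsShortest p → Shortest (fromWalk p)
  shortest-fromWalk p p-shortest {m} R = ≮⇒≥ λ m<ℓ → p-shortest m m<ℓ (toWalk R)

  shortest-retarget : ∀ {x y y' ℓ} {P : Walkℕ x y ℓ} → Shortest P → (y≡y' : y ≡ y') →
                      Shortest (retarget P y≡y')
  shortest-retarget P-shortest y≡y' R = P-shortest (retarget R (sym y≡y'))

  shortest-reverse : ∀ {x y ℓ} {P : Walkℕ x y ℓ} → Shortest P → Shortest (reverse P)
  shortest-reverse P-shortest R = P-shortest (reverse R)

  shortest-take : ∀ {x y ℓ} {P : Walkℕ x y ℓ} → Shortest P → ∀ {j} (j≤ℓ : j ≤ ℓ) →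
                  Shortest (take P j j≤ℓ)
  shortest-take {ℓ = ℓ} {P} P-shortest {j} j≤ℓ {m} R =
    +-cancelʳ-≤ (ℓ ∸ j) j m
      (subst (_≤ m + (ℓ ∸ j)) (sym (m+[n∸m]≡n j≤ℓ)) (P-shortest (R ++ drop P j j≤ℓ)))

  shortest⇒injective : ∀ {x y ℓ} {P : Walkℕ x y ℓ} → Shortest P →
                       ∀ {i j} → i < j → j ≤ ℓ → vert P i ≢ vert P j
  shortest⇒injective {P = P} P-shortest {i} i<j j≤ℓ same =
    <⇒≱ i<j (shortest-take {P = P} P-shortest j≤ℓ
               (retarget (take P i (≤-trans (<⇒≤ i<j) j≤ℓ)) same))

  shortest⇒nonBacktracking : ∀ {x y ℓ} {P : Walkℕ x y ℓ} → Shortest P →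
                             NonBacktracking (vert P) ℓ
  shortest⇒nonBacktracking {P = P} P-shortest t =
    shortest⇒injective {P = P} P-shortest (s≤s (n≤1+n t))

  shortest-to-neighbour : ∀ {x y ℓ} → Adj x y → (P : Walkℕ x y ℓ) → Shortest P → vert P 1 ≡ y
  shortest-to-neighbour {ℓ = zero} xy P _ with empty-walk-endpoints P
  ... | refl = ⊥-elim (irrefl xy)
  shortest-to-neighbour {ℓ = suc zero} _ P _ = end P
  shortest-to-neighbour {ℓ = suc (suc _)} xy P P-shortest with P-shortest (edge xy)
  ... | s≤s ()

  HasCycleOfLength≤ : ℕ → Set
  HasCycleOfLength≤ L = ∃[ m ] m ≤ L × HasCycleOfLength m

  hasCycleOfLength≤-mono : ∀ {L L'} → L ≤ L' → HasCycleOfLength≤ L → HasCycleOfLength≤ L'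
  hasCycleOfLength≤-mono L≤L' (m , m≤L , cycle) = m , ≤-trans m≤L L≤L' , cycle

  simple-return⇒cycle : ∀ {x y ℓ} (P : Walkℕ x y ℓ) → NonBacktracking (vert P) ℓ →
    ∀ d → 0 < d → (d≤ℓ : d ≤ ℓ) → vert P 0 ≡ vert P d →
    Injective _≡_ _≡_ (λ (r : Fin d) → vert P (toℕ r)) → HasCycleOfLength d
  simple-return⇒cycle P _ 1 _ d≤ℓ returns _ =
    ⊥-elim (irrefl (subst (Adj _) (sym returns) (step P 0 d≤ℓ)))
  simple-return⇒cycle P nb 2 _ d≤ℓ returns _ = ⊥-elim (nb 0 d≤ℓ returns)
  simple-return⇒cycle {x} P _ d@(suc (suc (suc _))) _ d≤ℓ returns injective =
    s≤s (s≤s (s≤s z≤n)) , x , toWalk (retarget (take P d d≤ℓ) (trans (sym returns) (start P))) ,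
    λ r r' same →
      injective (subst₂ (λ i i' → vert P i ≡ vert P i') (toℕ-inject₁ r) (toℕ-inject₁ r') same)

  nonBacktracking-return⇒cycle : ∀ {x y ℓ} (P : Walkℕ x y ℓ) → NonBacktracking (vert P) ℓ →
    ∀ d → 0 < d → d ≤ ℓ → vert P 0 ≡ vert P d → HasCycleOfLength≤ d
  nonBacktracking-return⇒cycle P nb d = <-rec Motive descend d P nb
    where
    Motive : ℕ → Set
    Motive d = ∀ {x y ℓ} (P : Walkℕ x y ℓ) → NonBacktracking (vert P) ℓ →
               0 < d → d ≤ ℓ → vert P 0 ≡ vert P d → HasCycleOfLength≤ d

    descend : ∀ d → (∀ {d'} → d' < d → Motive d') → Motive d
    descend d shorter P nb 0<d d≤ℓ returns-at-d with collides? _≟ᶠ_ (λ (r : Fin d) → vert P (toℕ r))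
    ... | no none =
      d , ≤-refl , simple-return⇒cycle P nb d 0<d d≤ℓ returns-at-d (¬collides⇒injective none)
    ... | yes (r , r' , r<r' , same) =
      hasCycleOfLength≤-mono (<⇒≤ d'<d)
        (shorter d'<d (drop P (toℕ r) r≤ℓ) (nonBacktracking-shift r≤ℓ nb)
                 (m<n⇒0<n∸m r<r') (∸-monoˡ-≤ (toℕ r) r'≤ℓ)
                 (trans same (cong (vert P) (sym (m∸n+n≡m (<⇒≤ r<r'))))))
      where
      d' = toℕ r' ∸ toℕ r
      d'<d : d' < d
      d'<d = ≤-<-trans (m∸n≤m (toℕ r') (toℕ r)) (toℕ<n r')
      r'≤ℓ : toℕ r' ≤ _
      r'≤ℓ = ≤-trans (<⇒≤ (toℕ<n r')) d≤ℓ
      r≤ℓ : toℕ r ≤ _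
      r≤ℓ = ≤-trans (<⇒≤ r<r') r'≤ℓ

  adjacent-geodesics⇒cycle : ∀ {u v w} c e → Adj u v →
    (P : Walkℕ u w c) → Shortest P → (Q : Walkℕ v w e) → Shortest Q →
    vert P 1 ≢ v → vert Q 1 ≢ u → HasCycleOfLength≤ (suc (c + e))
  adjacent-geodesics⇒cycle zero e uv P _ Q Q-shortest _ Q₁≢u with empty-walk-endpoints P
  ... | refl = ⊥-elim (Q₁≢u (shortest-to-neighbour (Adj-sym uv) Q Q-shortest))
  adjacent-geodesics⇒cycle (suc c) zero uv P P-shortest Q _ P₁≢v _ with empty-walk-endpoints Q
  ... | refl = ⊥-elim (P₁≢v (shortest-to-neighbour uv P P-shortest))
  adjacent-geodesics⇒cycle {v = v} (suc c) (suc e) uv P P-shortest Q Q-shortest P₁≢v Q₁≢u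
    with vert P c ≟ᶠ vert Q e
  ... | yes meet =
    hasCycleOfLength≤-mono (s≤s (+-mono-≤ (n≤1+n c) (n≤1+n e)))
      (adjacent-geodesics⇒cycle c e uv
        (take P c (n≤1+n c)) (shortest-take {P = P} P-shortest (n≤1+n c))
        (retarget (take Q e (n≤1+n e)) (sym meet))
        (shortest-retarget {P = take Q e (n≤1+n e)}
           (shortest-take {P = Q} Q-shortest (n≤1+n e)) (sym meet))
        P₁≢v Q₁≢u)
  ... | no apart =
    nonBacktracking-return⇒cycle W W-nonBacktracking _ (s≤s z≤n) ≤-refl
      (trans (start W) (sym (end W)))
    where
    -- NonBacktracking does not look across the base point v: only the turns at u and w count.
    W : Walkℕ v v (suc (suc c + suc e))
    W = edge (Adj-sym uv) ++ (P ++ reverse Q)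

    P-Q⁻¹-junction : vert P (suc c) ≡ vert (reverse Q) 0
    P-Q⁻¹-junction = trans (end P) (sym (end Q))

    P-Q⁻¹-nonBacktracking : NonBacktracking (vert (P ++ reverse Q)) (suc c + suc e)
    P-Q⁻¹-nonBacktracking =
      splice-nonBacktracking c (vert P) (vert (reverse Q))
        (shortest⇒nonBacktracking {P = P} P-shortest)
        (shortest⇒nonBacktracking {P = reverse Q} (shortest-reverse {P = Q} Q-shortest))
        P-Q⁻¹-junction apart

    P-Q⁻¹-second : vert (P ++ reverse Q) 1 ≡ vert P 1
    P-Q⁻¹-second =
      splice-≤ (suc c) (vert P) (vert (reverse Q)) P-Q⁻¹-junction (s≤s z≤n)

    W-nonBacktracking : NonBacktracking (vert W) (suc (suc c + suc e))
    W-nonBacktracking =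
      splice-nonBacktracking 0 (vert (edge (Adj-sym uv))) (vert (P ++ reverse Q))
        (λ _ → λ { (s≤s ()) }) P-Q⁻¹-nonBacktracking (sym (start P))
        (λ v≡ → P₁≢v (sym (trans v≡ P-Q⁻¹-second)))

  avoiding-walk-second-vertex : ∀ {S x y z ℓ} (p : Walk y z ℓ) → InternallyAvoids p S →
                                x ∈ S → x ≢ z → y ≢ z → vert (fromWalk p) 1 ≢ x
  avoiding-walk-second-vertex {ℓ = zero} p _ _ _ y≢z _ = y≢z (empty-walk-endpoints (fromWalk p))
  avoiding-walk-second-vertex {ℓ = suc zero} p _ _ x≢z _ p₁≡x =
    x≢z (trans (sym p₁≡x) (end (fromWalk p)))
  avoiding-walk-second-vertex {S} {ℓ = suc (suc _)} p avoids x∈S _ _ p₁≡x =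
    avoids second (s≤s z≤n) (s≤s (s≤s z≤n))
      (subst (_∈ S) (trans (sym p₁≡x) (walkVert-toℕ p second refl)) x∈S)
    where second = Fin.suc Fin.zero

  adjacent-members⇒cycle : ∀ {k S} → IsKDistMV k S → 3 ≤ ∣ S ∣ →
    ∀ {x y} → x ∈ S → y ∈ S → Adj x y → HasCycleOfLength≤ (suc (k + k))
  adjacent-members⇒cycle {S = S} mv 3≤∣S∣ {x} {y} x∈S y∈S xy with third-element S x y 3≤∣S∣
  ... | z , z∈S , z≢x , z≢y with mv x z x∈S z∈S | mv y z y∈S z∈S
  ... | a , a≤k , p , p-shortest , p-avoids | b , b≤k , q , q-shortest , q-avoids =
    hasCycleOfLength≤-mono (s≤s (+-mono-≤ a≤k b≤k))
      (adjacent-geodesics⇒cycle a b xy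
        (fromWalk p) (shortest-fromWalk p p-shortest)
        (fromWalk q) (shortest-fromWalk q q-shortest)
        (avoiding-walk-second-vertex p p-avoids y∈S (z≢y ∘ sym) (z≢x ∘ sym))
        (avoiding-walk-second-vertex q q-avoids x∈S (z≢x ∘ sym) (z≢y ∘ sym)))

lemma5p1 : (G : Graph) → Graph.Connected G →
    (g : ℕ) → Graph.Girth G g →
    (k : ℕ) → 1 ≤ k → k < g / 2 →
    (S : Subset (Graph.n G)) → Graph.IsKDistMV G k S → 3 ≤ ∣ S ∣ →
    Graph.Independent G S
lemma5p1 G _ g (_ , girth-minimal) k _ k<g/2 S mv 3≤∣S∣ x y x∈S y∈S xy
  with adjacent-members⇒cycle G mv 3≤∣S∣ x∈S y∈S xy
... | m , m≤2k+1 , cycle = <⇒≱ (≤-<-trans m≤2k+1 (m<n/2⇒1+2m<n k<g/2)) (girth-minimal m cycle)
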